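{- Let $n\ge 2$, $\sigma\in B_{n-1}$, and $\check\sigma:=[-n,\sigma(1),\ldots,\sigma(n-1)]\in B_n$. Then $\mathrm{oneg}(\check\sigma)=\mathrm{eneg}(\sigma)+1$, $\mathrm{eneg}(\check\sigma)=\mathrm{oneg}(\sigma)$, $\mathrm{oinv}(\check\sigma)=\mathrm{oinv}(\sigma)$, $\mathrm{einv}(\check\sigma)=\mathrm{einv}(\sigma)$, $\mathrm{onsp}(\check\sigma)=\mathrm{onsp}(\sigma)+\lceil\frac{n-1}{2}\rceil$, $\mathrm{ensp}(\check\sigma)=\mathrm{ensp}(\sigma)+\lfloor\frac{n-1}{2}\rfloor$.
   Context: $B_m$ is the group of signed permutations of $[m]$ (bijections $\sigma$ of $\{\pm1,\dots,\pm m\}$ with $\sigma(-i)=-\sigma(i)$), written in window notation $[\sigma(1),\dots,\sigma(m)]$. For $\sigma\in B_m$: $\mathrm{oneg}(\sigma)$ (resp. $\mathrm{eneg}(\sigma)$) is the number of $i\in[m]$ with $\sigma(i)<0$ and $i$ odd (resp. even); $\mathrm{oinv}(\sigma)$ (resp. $\mathrm{einv}(\sigma)$) is the number of pairs $1\le i<j\le m$ with $\sigma(i)>\sigma(j)$ and $j-i$ odd (resp. even); $\mathrm{onsp}(\sigma)$ (resp. $\mathrm{ensp}(\sigma)$) is the number of pairs $1\le i<j\le m$ with $\sigma(i)+\sigma(j)<0$ and $j-i$ odd (resp. even). -}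

module Defs where

open import Data.Nat using (ℕ; zero; suc; _+_; _≤_; _<_)
open import Data.Nat.Properties using (_≤?_; _<?_)
open import Data.Nat.DivMod using (_%_)
import Data.Nat.Properties as ℕP
open import Data.Integer as ℤ using (ℤ; -_; +_; ∣_∣)
import Data.Integer.Properties as ℤP
open import Data.Fin using (Fin; toℕ) renaming (zero to fzero; suc to fsuc)
open import Data.List using (List; filter; length; allFin; concatMap; map)
open import Data.Product using (_×_; _,_; proj₁; proj₂)
open import Relation.Nullary using (Dec; yes; no; _×-dec_; ¬_)
open import Relation.Unary using (Pred; Decidable)
import Agda.Primitive
open import Function.Definitions using (Injective)
open import Relation.Binary.PropositionalEquality using (_≡_)

-- A window of length m: position i (1-indexed) is toℕ i + 1.
Window : ℕ → Set
Window m = Fin m → ℤ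

record SignedPerm (m : ℕ) : Set where
  field
    window  : Window m
    inRange : ∀ i → 1 ≤ ∣ window i ∣ × ∣ window i ∣ ≤ m
    absInj  : Injective _≡_ _≡_ (λ i → ∣ window i ∣)
open SignedPerm public

odd? : (n : ℕ) → Dec (n % 2 ≡ 1)
odd? n = n % 2 ℕP.≟ 1

even? : (n : ℕ) → Dec (n % 2 ≡ 0)
even? n = n % 2 ℕP.≟ 0

pos : {m : ℕ} → Fin m → ℕ
pos i = suc (toℕ i)

pairs : (m : ℕ) → List (Fin m × Fin m)
pairs m = filter (λ p → toℕ (proj₁ p) <? toℕ (proj₂ p))
                 (concatMap (λ i → map (λ j → (i , j)) (allFin m)) (allFin m))

gap : {m : ℕ} → Fin m × Fin m → ℕ
gap (i , j) = toℕ j Data.Nat.∸ toℕ i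

count : {A : Set} {P : Pred A Agda.Primitive.lzero} → Decidable P → List A → ℕ
count d xs = length (filter d xs)

oneg eneg oinv einv onsp ensp : {m : ℕ} → Window m → ℕ
oneg {m} w = count (λ i → (w i ℤ.<? + 0) ×-dec odd? (pos i)) (allFin m)
eneg {m} w = count (λ i → (w i ℤ.<? + 0) ×-dec even? (pos i)) (allFin m)
oinv {m} w = count (λ p → (w (proj₂ p) ℤ.<? w (proj₁ p)) ×-dec odd? (gap p)) (pairs m)
einv {m} w = count (λ p → (w (proj₂ p) ℤ.<? w (proj₁ p)) ×-dec even? (gap p)) (pairs m)
onsp {m} w = count (λ p → ((w (proj₁ p) ℤ.+ w (proj₂ p)) ℤ.<? + 0) ×-dec odd? (gap p)) (pairs m)
ensp {m} w = count (λ p → ((w (proj₁ p) ℤ.+ w (proj₂ p)) ℤ.<? + 0) ×-dec even? (gap p)) (pairs m)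

-- σ̌ = [-n, σ(1), …, σ(n-1)] for σ ∈ B_{n-1}, with n = suc k
check : {k : ℕ} → Window k → Window (suc k)
check {k} w fzero    = - (+ (suc k))
check {k} w (fsuc i) = w i

module Submission where

-- Write n = k + 1, so σ ∈ B_k and the window of σ̌ is the window of
-- σ shifted one place to the right, with the new entry -n = -[1+ k ] in front.
--  * Positions.  Position 1 of σ̌ is odd and carries a negative entry, and shifting
--    a position flips its parity; hence oneg σ̌ = eneg σ + 1 and eneg σ̌ = oneg σ.
--  * Pairs.  The pairs of positions of [k+1] are the pairs (1, j+1) for j ∈ [k],
--    followed by the shifted pairs of [k].  Shifting preserves entries and gaps,
--    so each pair statistic of σ̌ is the number of pairs (1, j+1) with the property
--    plus the same statistic of σ.
--  * The pairs (1, j+1).  As |σ(j)| ≤ k, the entry -n is below every σ(j) and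
--    -n + σ(j) < 0: such a pair is never an inversion and always a negative-sum
--    pair.  Its gap is j, and ⌈k/2⌉ (resp. ⌊k/2⌋) of the j ∈ [k] are odd (even).

open import Defs
open import Data.Nat using (ℕ; zero; suc; _+_; _≤_; _<_; s≤s; z≤n; ⌈_/2⌉; ⌊_/2⌋)
import Data.Nat.Properties as ℕP
open import Data.Nat.DivMod using (_%_)
open import Data.Integer as ℤ using (+_; -[1+_]; ∣_∣)
import Data.Integer.Properties as ℤP
open import Data.Fin using (Fin; toℕ) renaming (zero to fzero; suc to fsuc)
open import Data.List using (List; []; _∷_; _++_; filter; length; allFin; concatMap; map)
import Data.List.Properties as LP
import Data.List.Relation.Unary.All as All
import Data.List.Relation.Unary.All.Properties as AllP
open import Data.Product using (_×_; _,_; proj₁; proj₂; map₂)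
open import Data.Bool using (true; false)
open import Relation.Nullary using (¬_; does; _×-dec_)
open import Relation.Unary using (Pred; Decidable; _≐_)
open import Relation.Binary.PropositionalEquality
  using (_≡_; refl; sym; trans; cong; cong₂; module ≡-Reasoning)
open import Function using (_∘_; id)
open import Level using (0ℓ)

private
  variable
    A B : Set
    k : ℕ

count-cong : {P Q : Pred A 0ℓ} (P? : Decidable P) (Q? : Decidable Q) →
             P ≐ Q → ∀ xs → count P? xs ≡ count Q? xs
count-cong P? Q? P≐Q xs = cong length (LP.filter-≐ P? Q? P≐Q xs)

count-++ : {P : Pred A 0ℓ} (P? : Decidable P) →
           ∀ xs ys → count P? (xs ++ ys) ≡ count P? xs + count P? ys
count-++ P? xs ys =
  trans (cong length (LP.filter-++ P? xs ys)) (LP.length-++ (filter P? xs))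

count-map : {P : Pred B 0ℓ} (P? : Decidable P) (f : A → B) →
            ∀ xs → count P? (map f xs) ≡ count (P? ∘ f) xs
count-map P? f []       = refl
count-map P? f (x ∷ xs) with does (P? (f x))
... | true  = cong suc (count-map P? f xs)
... | false = count-map P? f xs

count-none : {P : Pred A 0ℓ} (P? : Decidable P) → (∀ x → ¬ P x) →
             ∀ xs → count P? xs ≡ 0
count-none P? ¬P xs = cong length (LP.filter-none P? (All.universal ¬P xs))

filter-map : {P : Pred B 0ℓ} {Q : Pred A 0ℓ} (P? : Decidable P) (Q? : Decidable Q)
             (f : A → B) → (∀ x → does (P? (f x)) ≡ does (Q? x)) →
             ∀ xs → filter P? (map f xs) ≡ map f (filter Q? xs)
filter-map P? Q? f agree []       = refl
filter-map P? Q? f agree (x ∷ xs)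
  with does (P? (f x)) | does (Q? x) | agree x
... | true  | .true  | refl = cong (f x ∷_) (filter-map P? Q? f agree xs)
... | false | .false | refl = filter-map P? Q? f agree xs

filter-concatMap : {P : Pred B 0ℓ} (P? : Decidable P) (f : A → List B) →
                   ∀ xs → filter P? (concatMap f xs) ≡ concatMap (filter P? ∘ f) xs
filter-concatMap P? f []       = refl
filter-concatMap P? f (x ∷ xs) =
  trans (LP.filter-++ P? (f x) (concatMap f xs))
        (cong (filter P? (f x) ++_) (filter-concatMap P? f xs))

allFin-suc : ∀ k → allFin (suc k) ≡ fzero ∷ map fsuc (allFin k)
allFin-suc k = cong (fzero ∷_) (sym (LP.map-tabulate id fsuc))

count-allFin-suc : {P : Pred (Fin (suc k)) 0ℓ} (P? : Decidable P) →
  count P? (allFin (suc k)) ≡ count P? (fzero ∷ []) + count (P? ∘ fsuc) (allFin k)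
count-allFin-suc {k} P? = begin
  count P? (allFin (suc k))                         ≡⟨ cong (count P?) (allFin-suc k) ⟩
  count P? ((fzero ∷ []) ++ map fsuc (allFin k))    ≡⟨ count-++ P? (fzero ∷ []) _ ⟩
  count P? (fzero ∷ []) + count P? (map fsuc (allFin k))
    ≡⟨ cong (λ c → count P? (fzero ∷ []) + c) (count-map P? fsuc (allFin k)) ⟩
  count P? (fzero ∷ []) + count (P? ∘ fsuc) (allFin k) ∎
  where open ≡-Reasoning

Pair : ℕ → Set
Pair m = Fin m × Fin m

Ordered : (m : ℕ) → Pred (Pair m) 0ℓ
Ordered m (i , j) = toℕ i < toℕ j

ordered? : (m : ℕ) → Decidable (Ordered m)
ordered? m (i , j) = toℕ i ℕP.<? toℕ j

row : (m : ℕ) → Fin m → List (Pair m)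
row m i = map (λ j → (i , j)) (allFin m)

fromFirst : Fin k → Pair (suc k)
fromFirst j = (fzero , fsuc j)

shift : Pair k → Pair (suc k)
shift (i , j) = (fsuc i , fsuc j)

row-suc : ∀ k i → row (suc k) i ≡ (i , fzero) ∷ map (λ j → (i , fsuc j)) (allFin k)
row-suc k i = trans (cong (map (λ j → (i , j))) (allFin-suc k))
                    (cong ((i , fzero) ∷_) (sym (LP.map-∘ (allFin k))))

-- In the first row every pair except (1, 1) is ordered.
first-row : ∀ k → filter (ordered? (suc k)) (row (suc k) fzero) ≡ map fromFirst (allFin k)
first-row k = trans (cong (filter (ordered? (suc k))) (row-suc k fzero))
  (LP.filter-all (ordered? (suc k)) (AllP.map⁺ (All.universal (λ _ → s≤s z≤n) (allFin k))))

-- The other rows, with the unordered pair (i+1, 1) removed, are shifted rows of [k].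
shifted-row : ∀ k i → filter (ordered? (suc k)) (row (suc k) (fsuc i))
                      ≡ map shift (filter (ordered? k) (row k i))
shifted-row k i = begin
  filter (ordered? (suc k)) (row (suc k) (fsuc i))
    ≡⟨ cong (filter (ordered? (suc k))) (row-suc k (fsuc i)) ⟩
  filter (ordered? (suc k)) (map (λ j → (fsuc i , fsuc j)) (allFin k))
    ≡⟨ cong (filter (ordered? (suc k))) (LP.map-∘ (allFin k)) ⟩
  filter (ordered? (suc k)) (map shift (row k i))
    ≡⟨ filter-map (ordered? (suc k)) (ordered? k) shift (λ _ → refl) (row k i) ⟩
  map shift (filter (ordered? k) (row k i)) ∎
  where open ≡-Reasoning

pairs-suc : ∀ k → pairs (suc k) ≡ map fromFirst (allFin k) ++ map shift (pairs k)
pairs-suc k = begin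
  filter lt′ (concatMap (row (suc k)) (allFin (suc k)))
    ≡⟨ filter-concatMap lt′ (row (suc k)) (allFin (suc k)) ⟩
  concatMap (filter lt′ ∘ row (suc k)) (allFin (suc k))
    ≡⟨ cong (concatMap (filter lt′ ∘ row (suc k))) (allFin-suc k) ⟩
  filter lt′ (row (suc k) fzero) ++ concatMap (filter lt′ ∘ row (suc k)) (map fsuc (allFin k))
    ≡⟨ cong₂ _++_ (first-row k) (LP.concatMap-map (filter lt′ ∘ row (suc k)) fsuc (allFin k)) ⟩
  map fromFirst (allFin k) ++ concatMap (filter lt′ ∘ row (suc k) ∘ fsuc) (allFin k)
    ≡⟨ cong (map fromFirst (allFin k) ++_) (LP.concatMap-cong (shifted-row k) (allFin k)) ⟩
  map fromFirst (allFin k) ++ concatMap (map shift ∘ filter lt ∘ row k) (allFin k)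
    ≡⟨ cong (map fromFirst (allFin k) ++_) (sym (LP.map-concatMap shift (filter lt ∘ row k) (allFin k))) ⟩
  map fromFirst (allFin k) ++ map shift (concatMap (filter lt ∘ row k) (allFin k))
    ≡⟨ cong (λ ps → map fromFirst (allFin k) ++ map shift ps) (sym (filter-concatMap lt (row k) (allFin k))) ⟩
  map fromFirst (allFin k) ++ map shift (pairs k) ∎
  where
  open ≡-Reasoning
  lt′ : Decidable (Ordered (suc k))
  lt′ = ordered? (suc k)
  lt : Decidable (Ordered k)
  lt = ordered? k

count-pairs-suc : {P : Pred (Pair (suc k)) 0ℓ} (P? : Decidable P) →
  count P? (pairs (suc k)) ≡ count (P? ∘ fromFirst) (allFin k) + count (P? ∘ shift) (pairs k)
count-pairs-suc {k} P? =
  trans (cong (count P?) (pairs-suc k))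
        (trans (count-++ P? (map fromFirst (allFin k)) _)
               (cong₂ _+_ (count-map P? fromFirst (allFin k)) (count-map P? shift (pairs k))))

odd-suc⇒even : ∀ n → suc n % 2 ≡ 1 → n % 2 ≡ 0
odd-suc⇒even zero          _  = refl
odd-suc⇒even (suc zero)    ()
odd-suc⇒even (suc (suc n)) e  = odd-suc⇒even n e

even⇒odd-suc : ∀ n → n % 2 ≡ 0 → suc n % 2 ≡ 1
even⇒odd-suc zero          _  = refl
even⇒odd-suc (suc zero)    ()
even⇒odd-suc (suc (suc n)) e  = even⇒odd-suc n e

even-suc⇒odd : ∀ n → suc n % 2 ≡ 0 → n % 2 ≡ 1
even-suc⇒odd zero          ()
even-suc⇒odd (suc zero)    _  = refl
even-suc⇒odd (suc (suc n)) e  = even-suc⇒odd n e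

odd⇒even-suc : ∀ n → n % 2 ≡ 1 → suc n % 2 ≡ 0
odd⇒even-suc zero          ()
odd⇒even-suc (suc zero)    _  = refl
odd⇒even-suc (suc (suc n)) e  = odd⇒even-suc n e

odd-suc≐even : (Q : Pred A 0ℓ) (f : A → ℕ) →
  (λ x → Q x × suc (f x) % 2 ≡ 1) ≐ (λ x → Q x × f x % 2 ≡ 0)
odd-suc≐even Q f = (λ {x} → map₂ (odd-suc⇒even (f x))) , (λ {x} → map₂ (even⇒odd-suc (f x)))

even-suc≐odd : (Q : Pred A 0ℓ) (f : A → ℕ) →
  (λ x → Q x × suc (f x) % 2 ≡ 0) ≐ (λ x → Q x × f x % 2 ≡ 1)
even-suc≐odd Q f = (λ {x} → map₂ (even-suc⇒odd (f x))) , (λ {x} → map₂ (odd⇒even-suc (f x)))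

-- The numbers of odd and even positions in [k] (equivalently, of odd and even
-- gaps j among the pairs (1, j+1) of [k+1]).
oddPositions evenPositions : ℕ → ℕ
oddPositions  k = count (λ (i : Fin k) → odd?  (pos i)) (allFin k)
evenPositions k = count (λ (i : Fin k) → even? (pos i)) (allFin k)

oddPositions≡⌈/2⌉  : ∀ k → oddPositions  k ≡ ⌈ k /2⌉
evenPositions≡⌊/2⌋ : ∀ k → evenPositions k ≡ ⌊ k /2⌋
oddPositions≡⌈/2⌉ zero    = refl
oddPositions≡⌈/2⌉ (suc k) =
  trans (count-allFin-suc {k} (λ i → odd? (pos i)))
        (cong suc (trans (count-cong _ _ odd-suc≐even′ (allFin k)) (evenPositions≡⌊/2⌋ k)))
  where
  odd-suc≐even′ : (λ (i : Fin k) → suc (pos i) % 2 ≡ 1) ≐ (λ i → pos i % 2 ≡ 0)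
  odd-suc≐even′ = (λ {i} → odd-suc⇒even (pos i)) , (λ {i} → even⇒odd-suc (pos i))
evenPositions≡⌊/2⌋ zero    = refl
evenPositions≡⌊/2⌋ (suc k) =
  trans (count-allFin-suc {k} (λ i → even? (pos i)))
        (trans (count-cong _ _ even-suc≐odd′ (allFin k)) (oddPositions≡⌈/2⌉ k))
  where
  even-suc≐odd′ : (λ (i : Fin k) → suc (pos i) % 2 ≡ 0) ≐ (λ i → pos i % 2 ≡ 1)
  even-suc≐odd′ = (λ {i} → even-suc⇒odd (pos i)) , (λ {i} → odd⇒even-suc (pos i))

not-below : ∀ k x → ∣ x ∣ ≤ k → ¬ (x ℤ.< -[1+ k ])
not-below k (+ n)    _   ()
not-below k -[1+ n ] n≤k (ℤ.-<- k<n) = ℕP.<-asym n≤k k<n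

sum-negative : ∀ k x → ∣ x ∣ ≤ k → -[1+ k ] ℤ.+ x ℤ.< + 0
sum-negative k -[1+ n ] _ = ℤ.-<+
sum-negative k (+ n) n≤k rewrite ℤP.⊖-< {n} {suc k} (s≤s n≤k) | ℕP.+-∸-assoc 1 n≤k = ℤ.-<+

module _ {k : ℕ} (w : Window k) where

  oneg-check : oneg (check w) ≡ eneg w + 1
  oneg-check = begin
    oneg (check w)
      ≡⟨ count-allFin-suc (λ i → (check w i ℤ.<? + 0) ×-dec odd? (pos i)) ⟩
    suc (count (λ i → (w i ℤ.<? + 0) ×-dec odd? (suc (pos i))) (allFin k))
      ≡⟨ cong suc (count-cong _ _ (odd-suc≐even (λ i → w i ℤ.< + 0) pos) (allFin k)) ⟩
    suc (eneg w)
      ≡⟨ ℕP.+-comm 1 (eneg w) ⟩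
    eneg w + 1 ∎
    where open ≡-Reasoning

  eneg-check : eneg (check w) ≡ oneg w
  eneg-check =
    trans (count-allFin-suc (λ i → (check w i ℤ.<? + 0) ×-dec even? (pos i)))
          (count-cong _ _ (even-suc≐odd (λ i → w i ℤ.< + 0) pos) (allFin k))

  module _ (bound : ∀ j → ∣ w j ∣ ≤ k) where

    no-first-inversion : {R : Pred (Fin k) 0ℓ} (R? : Decidable R) →
      count (λ j → (w j ℤ.<? -[1+ k ]) ×-dec R? j) (allFin k) ≡ 0
    no-first-inversion R? =
      count-none _ (λ j → not-below k (w j) (bound j) ∘ proj₁) (allFin k)

    all-first-negative : {R : Pred (Fin k) 0ℓ} (R? : Decidable R) →
      count (λ j → (-[1+ k ] ℤ.+ w j ℤ.<? + 0) ×-dec R? j) (allFin k) ≡ count R? (allFin k)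
    all-first-negative R? =
      count-cong _ R? (proj₂ , λ {j} r → sum-negative k (w j) (bound j) , r) (allFin k)

    oinv-check : oinv (check w) ≡ oinv w
    oinv-check =
      trans (count-pairs-suc (λ p → (check w (proj₂ p) ℤ.<? check w (proj₁ p)) ×-dec odd? (gap p)))
            (cong (_+ oinv w) (no-first-inversion (λ j → odd? (pos j))))

    einv-check : einv (check w) ≡ einv w
    einv-check =
      trans (count-pairs-suc (λ p → (check w (proj₂ p) ℤ.<? check w (proj₁ p)) ×-dec even? (gap p)))
            (cong (_+ einv w) (no-first-inversion (λ j → even? (pos j))))

    onsp-check : onsp (check w) ≡ onsp w + ⌈ k /2⌉
    onsp-check = begin
      onsp (check w)
        ≡⟨ count-pairs-suc (λ p → ((check w (proj₁ p) ℤ.+ check w (proj₂ p)) ℤ.<? + 0) ×-dec odd? (gap p)) ⟩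
      count (λ j → (-[1+ k ] ℤ.+ w j ℤ.<? + 0) ×-dec odd? (pos j)) (allFin k) + onsp w
        ≡⟨ cong (_+ onsp w) (trans (all-first-negative _) (oddPositions≡⌈/2⌉ k)) ⟩
      ⌈ k /2⌉ + onsp w
        ≡⟨ ℕP.+-comm ⌈ k /2⌉ (onsp w) ⟩
      onsp w + ⌈ k /2⌉ ∎
      where open ≡-Reasoning

    ensp-check : ensp (check w) ≡ ensp w + ⌊ k /2⌋
    ensp-check = begin
      ensp (check w)
        ≡⟨ count-pairs-suc (λ p → ((check w (proj₁ p) ℤ.+ check w (proj₂ p)) ℤ.<? + 0) ×-dec even? (gap p)) ⟩
      count (λ j → (-[1+ k ] ℤ.+ w j ℤ.<? + 0) ×-dec even? (pos j)) (allFin k) + ensp w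
        ≡⟨ cong (_+ ensp w) (trans (all-first-negative _) (evenPositions≡⌊/2⌋ k)) ⟩
      ⌊ k /2⌋ + ensp w
        ≡⟨ ℕP.+-comm ⌊ k /2⌋ (ensp w) ⟩
      ensp w + ⌊ k /2⌋ ∎
      where open ≡-Reasoning

-- The theorem: the entries of a signed permutation of [k] have absolute value ≤ k.
mainTheorem6 : (k : ℕ) → 2 ≤ suc k → (σ : SignedPerm k) →
    let w = window σ in
    (oneg (check w) ≡ eneg w + 1) ×
    (eneg (check w) ≡ oneg w) ×
    (oinv (check w) ≡ oinv w) ×
    (einv (check w) ≡ einv w) ×
    (onsp (check w) ≡ onsp w + ⌈ k /2⌉) ×
    (ensp (check w) ≡ ensp w + ⌊ k /2⌋)
mainTheorem6 k _ σ =
  oneg-check w , eneg-check w ,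
  oinv-check w bound , einv-check w bound , onsp-check w bound , ensp-check w bound
  where
  w : Window k
  w = window σ
  bound : ∀ j → ∣ w j ∣ ≤ k
  bound j = proj₂ (inRange σ j)
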